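{- Let $k \geq 2$ and $b \geq 3$ be integers and let $q(x) = b^x + 2x$. For each $l \in \{k-1, k, \dots, k + b^{k-1} - 2\}$, there exists a path of length $l$ in the graph $H_b(k)$ from the vertex $1$ to the vertex $q(k-1)$ that contains exactly $k-1$ chord edges.
   Context: For integers $b \geq 3$, $i \geq 1$, $e \geq 0$, the graph $G_b(i,e)$ has vertex set $\{i, i+1, \dots, i+2+b^{e+1}-b^e\}$ and edge set $\{\{j,j+1\} : i \leq j \leq i+1+b^{e+1}-b^e\} \cup \{\{i, i+2+jb^e\} : 0 \leq j \leq b-1\}$; the edges $\{i, i+2+jb^e\}$, $0 \leq j \leq b-1$, are its base chords. Let $q(x) = b^x + 2x$ (so $q(0)=1$ and the last vertex of $G_b(q(e),e)$ is $q(e+1)$). The graph $H_b(k)$ is the union $\bigcup_{e=0}^{k-1} G_b(q(e),e)$, i.e., the graph whose vertex set is the union of the vertex sets and whose edge set is the union of the edge sets of the graphs $G_b(q(e),e)$, $0 \leq e \leq k-1$. An edge of $H_b(k)$ is a chord edge if it is a base chord of some $G_b(q(e),e)$, $0 \le e \le k-1$. -}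

module Defs where

open import Data.Nat using (ℕ; zero; suc; _+_; _*_; _∸_; _^_; _≤_; _<_; _≡ᵇ_)
open import Data.Bool using (Bool; true; false; _∧_; _∨_)
open import Data.List using (List; []; _∷_; length; upTo)
open import Data.Bool.ListAction using (any)
open import Data.Product using (_×_; _,_; ∃-syntax)
open import Data.Sum using (_⊎_)
open import Relation.Binary.PropositionalEquality using (_≡_)

q : ℕ → ℕ → ℕ
q b x = b ^ x + 2 * x

GEdgeDir : ℕ → ℕ → ℕ → ℕ → ℕ → Set
GEdgeDir b i e u v =
  (i ≤ u × u ≤ i + 1 + (b ^ (suc e) ∸ b ^ e) × v ≡ suc u)
  ⊎
  (u ≡ i × ∃[ j ] (j < b × v ≡ i + 2 + j * b ^ e))

GEdge : ℕ → ℕ → ℕ → ℕ → ℕ → Set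
GEdge b i e u v = GEdgeDir b i e u v ⊎ GEdgeDir b i e v u

HEdge : ℕ → ℕ → ℕ → ℕ → Set
HEdge b k u v = ∃[ e ] (e < k × GEdge b (q b e) e u v)

isChord : ℕ → ℕ → ℕ → ℕ → Bool
isChord b k u v =
  any (λ e → any (λ j →
        let x = q b e ; y = q b e + 2 + j * b ^ e in
        ((u ≡ᵇ x) ∧ (v ≡ᵇ y)) ∨ ((u ≡ᵇ y) ∧ (v ≡ᵇ x))) (upTo b)) (upTo k)

data IsPathIn (E : ℕ → ℕ → Set) : List ℕ → Set where
  single : ∀ v → IsPathIn E (v ∷ [])
  step   : ∀ u v vs → E u v → IsPathIn E (v ∷ vs) → IsPathIn E (u ∷ v ∷ vs)

countEdges : (ℕ → ℕ → Bool) → List ℕ → ℕ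
countEdges P [] = 0
countEdges P (u ∷ []) = 0
countEdges P (u ∷ v ∷ vs) = add (P u v) (countEdges P (v ∷ vs))
  where
  add : Bool → ℕ → ℕ
  add true  n = suc n
  add false n = n

data First : List ℕ → ℕ → Set where
  first : ∀ v vs → First (v ∷ vs) v

data Last : List ℕ → ℕ → Set where
  lastOne  : ∀ v → Last (v ∷ []) v
  lastMore : ∀ u vs w → Last vs w → Last (u ∷ vs) w

-- Entering G_b(q(e),e) through its base chord to q(e) + 2 + j·bᵉ and then following path
-- edges up to q(e+1) uses one chord edge and 1 + (b-1-j)·bᵉ edges. Doing this for every
-- e < k-1 gives a strictly increasing, hence simple, path from q(0) = 1 to q(k-1) with k-1
-- chord edges and length (k-1) + Σ mₑ·bᵉ for arbitrary digits mₑ = b-1-j < b; writing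
-- l - (k-1) < b^(k-1) in base b realises every length in the range.
module Submission where

open import Defs
open import Data.Nat using (ℕ; zero; suc; _+_; _*_; _∸_; _^_; _≤_; _<_; _≡ᵇ_; z≤n; s≤s; z<s)
open import Data.Nat.Properties
open import Data.Nat.DivMod using (_/_; _%_; m≡m%n+[m/n]*n; m%n<n; m<n*o⇒m/o<n)
open import Data.Nat.Tactic.RingSolver using (solve-∀)
open import Data.Bool using (Bool; true; false; T; _∧_; _∨_)
open import Data.Bool.Properties using (T-∨; T-∧)
open import Data.List using ([]; _∷_; length; upTo)
open import Data.List.Relation.Unary.Any using (satisfied)
open import Data.List.Relation.Unary.Any.Properties using (any⁺; any⁻)
open import Data.List.Membership.Propositional using (lose)
open import Data.List.Membership.Propositional.Properties using (∈-upTo⁺)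
open import Data.List.Relation.Unary.Linked using (Linked; [-]; _∷_)
open import Data.List.Relation.Unary.Linked.Properties using (Linked⇒AllPairs)
open import Data.List.Relation.Unary.AllPairs as AllPairs using ()
open import Data.List.Relation.Unary.Unique.Propositional using (Unique)
open import Data.Product using (_×_; _,_; ∃-syntax)
open import Data.Sum using (inj₁; inj₂)
open import Data.Empty using (⊥-elim)
open import Function.Bundles using (Equivalence)
open import Relation.Nullary using (¬_)
open import Relation.Binary.PropositionalEquality

open Equivalence using (to; from)

1+n<n+2+m : ∀ X t → suc X < X + 2 + t
1+n<n+2+m X t = ≤-trans (≤-reflexive (+-comm 2 X)) (m≤m+n (X + 2) t)

¬isChord-suc : ∀ b k x → ¬ T (isChord b k x (suc x))
¬isChord-suc b k x chord
  with e , chordₑ ← satisfied (any⁻ _ (upTo k) chord)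
  with j , hit ← satisfied (any⁻ _ (upTo b) chordₑ)
  with T-∨ .to hit
... | inj₁ fwd with x≡X , sx≡Y ← T-∧ .to fwd =
  <⇒≢ (1+n<n+2+m (q b e) (j * b ^ e))
    (trans (cong suc (sym (≡ᵇ⇒≡ x _ x≡X))) (≡ᵇ⇒≡ (suc x) _ sx≡Y))
... | inj₂ bwd with x≡Y , sx≡X ← T-∧ .to bwd =
  <-asym (subst (q b e <_) (sym (≡ᵇ⇒≡ x _ x≡Y)) (<-trans (n<1+n _) (1+n<n+2+m (q b e) (j * b ^ e))))
    (subst (x <_) (≡ᵇ⇒≡ (suc x) _ sx≡X) (n<1+n x))

isChord-baseChord : ∀ b k e j → e < k → j < b → T (isChord b k (q b e) (q b e + 2 + j * b ^ e))
isChord-baseChord b k e j e<k j<b =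
  any⁺ _ (lose (∈-upTo⁺ e<k) (any⁺ _ (lose (∈-upTo⁺ j<b)
    (hit (q b e) (q b e + 2 + j * b ^ e) _))))
  where
  hit : ∀ X Y r → T ((X ≡ᵇ X) ∧ (Y ≡ᵇ Y) ∨ r)
  hit X Y r = T-∨ .from (inj₁ (T-∧ .from (≡⇒≡ᵇ X X refl , ≡⇒≡ᵇ Y Y refl)))

module Ascents (E : ℕ → ℕ → Set) (P : ℕ → ℕ → Bool) where

  Ascent : ℕ → ℕ → ℕ → ℕ → Set
  Ascent u z l c = ∃[ vs ] (IsPathIn E (u ∷ vs) × Linked _<_ (u ∷ vs) × Last (u ∷ vs) z ×
                           length vs ≡ l × countEdges P (u ∷ vs) ≡ c)

  ascent-stop : ∀ z → Ascent z z 0 0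
  ascent-stop z = [] , single z , [-] , lastOne z , refl , refl

  countEdges-plain : ∀ {u v} vs → P u v ≡ false → countEdges P (u ∷ v ∷ vs) ≡ countEdges P (v ∷ vs)
  countEdges-plain vs eq rewrite eq = refl

  countEdges-chord : ∀ {u v} vs → P u v ≡ true → countEdges P (u ∷ v ∷ vs) ≡ suc (countEdges P (v ∷ vs))
  countEdges-chord vs eq rewrite eq = refl

  ascent-edge : ∀ {u v z l c} → E u v → u < v → ¬ T (P u v) → Ascent v z l c → Ascent u z (suc l) c
  ascent-edge {u} {v} e u<v ¬p (vs , path , asc , last , len , count) with P u v in eq
  ... | false = v ∷ vs , step u v vs e path , u<v ∷ asc , lastMore u _ _ last , cong suc len ,
                trans (countEdges-plain vs eq) count
  ... | true  = ⊥-elim (¬p _)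

  ascent-chord : ∀ {u v z l c} → E u v → u < v → T (P u v) → Ascent v z l c → Ascent u z (suc l) (suc c)
  ascent-chord {u} {v} e u<v p (vs , path , asc , last , len , count) with P u v in eq
  ... | true = v ∷ vs , step u v vs e path , u<v ∷ asc , lastMore u _ _ last , cong suc len ,
               trans (countEdges-chord vs eq) (cong suc count)

  ascent-run : ∀ n {a z l c} → (∀ x → a ≤ x → x < a + n → E x (suc x) × ¬ T (P x (suc x))) →
               Ascent (a + n) z l c → Ascent a z (n + l) c
  ascent-run zero {a} {z} {l} {c} _ asc = subst (λ u → Ascent u z l c) (+-identityʳ a) asc
  ascent-run (suc n) {a} {z} {l} {c} run asc with edge , ¬p ← run a ≤-refl (m<m+n a z<s) =
    ascent-edge edge (n<1+n a) ¬p
      (ascent-run n (λ x a<x x<a+n → run x (<⇒≤ a<x) (subst (x <_) (sym (+-suc a n)) x<a+n))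
                    (subst (λ u → Ascent u z l c) (+-suc a n) asc))

  ascent⇒path : ∀ {u z l c} → Ascent u z l c →
                ∃[ ps ] (IsPathIn E ps × Unique ps × length ps ≡ suc l ×
                         First ps u × Last ps z × countEdges P ps ≡ c)
  ascent⇒path {u} (vs , path , asc , last , len , count) =
    u ∷ vs , path , AllPairs.map <⇒≢ (Linked⇒AllPairs <-trans asc) , cong suc len ,
    first u vs , last , count

module HGraph (b' K : ℕ) where

  private
    b : ℕ
    b = suc b'

  open Ascents (HEdge b K) (isChord b K)

  q-suc : ∀ e → q b (suc e) ≡ q b e + 2 + b' * b ^ e
  q-suc e = expand (b ^ e) b' e
    where
    expand : ∀ B c e → (B + c * B) + 2 * suc e ≡ (B + 2 * e) + 2 + c * B
    expand = solve-∀

  H-pathEdge : ∀ {e x} → e < K → q b e ≤ x → x < q b (suc e) → HEdge b K x (suc x)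
  H-pathEdge {e} {x} e<K qₑ≤x x<qₑ₊₁ = e , e<K , inj₁ (inj₁ (qₑ≤x , x≤ , refl))
    where
    x≤ : x ≤ q b e + 1 + (b ^ suc e ∸ b ^ e)
    x≤ = begin
      x                                  ≤⟨ ≤-pred (subst (x <_) (trans (q-suc e) (+2≡suc+1 (q b e) _)) x<qₑ₊₁) ⟩
      q b e + 1 + b' * b ^ e             ≡⟨ cong (q b e + 1 +_) (sym (m+n∸m≡n (b ^ e) _)) ⟩
      q b e + 1 + (b ^ suc e ∸ b ^ e)    ∎
      where
      open ≤-Reasoning
      +2≡suc+1 : ∀ X t → X + 2 + t ≡ suc (X + 1 + t)
      +2≡suc+1 = solve-∀

  H-baseChord : ∀ {e j} → e < K → j < b → HEdge b K (q b e) (q b e + 2 + j * b ^ e)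
  H-baseChord {e} {j} e<K j<b = e , e<K , inj₁ (inj₂ (refl , j , j<b , refl))

  ascent-level : ∀ {e m z l c} → e < K → m ≤ b' → Ascent (q b (suc e)) z l c →
                 Ascent (q b e) z (suc (m * b ^ e) + l) (suc c)
  ascent-level {e} {m} {z} {l} {c} e<K m≤b' asc =
    ascent-chord (H-baseChord e<K j<b) qₑ<a
      (isChord-baseChord b K e j e<K j<b)
      (ascent-run (m * b ^ e) run (subst (λ u → Ascent u z l c) (sym end) asc))
    where
    j = b' ∸ m
    j<b : j < b
    j<b = s≤s (m∸n≤m b' m)
    a = q b e + 2 + j * b ^ e
    qₑ<a : q b e < a
    qₑ<a = <-trans (n<1+n _) (1+n<n+2+m (q b e) (j * b ^ e))
    end : a + m * b ^ e ≡ q b (suc e)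
    end = begin
      q b e + 2 + j * b ^ e + m * b ^ e      ≡⟨ +-assoc (q b e + 2) _ _ ⟩
      q b e + 2 + (j * b ^ e + m * b ^ e)    ≡⟨ cong (q b e + 2 +_) (sym (*-distribʳ-+ (b ^ e) j m)) ⟩
      q b e + 2 + (j + m) * b ^ e            ≡⟨ cong (λ i → q b e + 2 + i * b ^ e) (m∸n+n≡m m≤b') ⟩
      q b e + 2 + b' * b ^ e                 ≡⟨ sym (q-suc e) ⟩
      q b (suc e)                            ∎
      where open ≡-Reasoning
    run : ∀ x → a ≤ x → x < a + m * b ^ e → HEdge b K x (suc x) × ¬ T (isChord b K x (suc x))
    run x a≤x x<end = H-pathEdge e<K (≤-trans (<⇒≤ qₑ<a) a≤x) (subst (x <_) end x<end) , ¬isChord-suc b K x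

  ascent-digits : ∀ d e → d + e ≤ K → ∀ s → s < b ^ d →
                  Ascent (q b e) (q b (d + e)) (d + s * b ^ e) d
  ascent-digits zero    e _ zero    _        = ascent-stop (q b e)
  ascent-digits zero    e _ (suc s) (s≤s ())
  ascent-digits (suc d) e le s s<bᵈ⁺¹ =
    subst₂ (λ z l → Ascent (q b e) z l (suc d)) (cong (q b) (+-suc d e)) digit-sum
      (ascent-level (≤-trans (s≤s (m≤n+m e d)) le) (≤-pred (m%n<n s b))
        (ascent-digits d (suc e) (subst (_≤ K) (sym (+-suc d e)) le) (s / b)
          (m<n*o⇒m/o<n (subst (s <_) (*-comm b (b ^ d)) s<bᵈ⁺¹))))
    where
    collect : ∀ m B d t c → m * B + (d + t * (c * B)) ≡ d + (m + t * c) * B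
    collect = solve-∀
    digit-sum : suc (s % b * b ^ e) + (d + s / b * b ^ suc e) ≡ suc d + s * b ^ e
    digit-sum = cong suc (trans (collect (s % b) (b ^ e) d (s / b) b)
                             (cong (λ t → d + t * b ^ e) (sym (m≡m%n+[m/n]*n s b))))

lemma4 : (b k : ℕ) → 2 ≤ k → 3 ≤ b → (l : ℕ) → k ∸ 1 ≤ l → l ≤ k + b ^ (k ∸ 1) ∸ 2 →
    ∃[ ps ] (IsPathIn (HEdge b k) ps × Unique ps × length ps ≡ suc l ×
      First ps 1 × Last ps (q b (k ∸ 1)) × countEdges (isChord b k) ps ≡ k ∸ 1)
lemma4 (suc b') (suc (suc d)) (s≤s (s≤s z≤n)) (s≤s _) l d<l l≤ =
  ascent⇒path (subst₂ (λ z n → Ascent 1 z n (suc d)) (cong (q b) (+-identityʳ (suc d))) path-length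
    (ascent-digits (suc d) 0 (≤-trans (≤-reflexive (+-identityʳ (suc d))) (n≤1+n _)) s s<bᵈ))
  where
  b = suc b'
  open HGraph b' (suc (suc d))
  open Ascents (HEdge b (suc (suc d))) (isChord b (suc (suc d)))
  s = l ∸ suc d
  d+s≡l : suc d + s ≡ l
  d+s≡l = m+[n∸m]≡n d<l
  s<bᵈ : s < b ^ suc d
  s<bᵈ = +-cancelˡ-≤ d _ _ (subst (_≤ d + b ^ suc d) (trans (sym d+s≡l) (sym (+-suc d s))) l≤)
  path-length : suc d + s * b ^ 0 ≡ l
  path-length = trans (cong (suc d +_) (*-identityʳ s)) d+s≡l
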